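{- The number of line complexes on an $8$-point set $P$ that contain at least one isolated tree and omit no point is $200{,}970$.
   Context: $P$ is a set of $8$ points (the points of $\mathbb F_2^3$). A line is a $2$-element subset of $P$; there are $28$ lines. A line complex is a set of exactly $8$ distinct lines. $\mathcal C$ omits $p$ if no line of $\mathcal C$ contains $p$. Viewing $\mathcal C$ as a graph with vertex set $P$ and edge set $\mathcal C$, an isolated tree is a connected component containing at least one line which is a tree (e.g. an isolated line, i.e. a line meeting no other line of $\mathcal C$). -}

module Defs where

open import Data.Nat using (ℕ; _≥_)
open import Data.Fin using (Fin; toℕ)
open import Data.Fin.Properties using (_<?_)
open import Data.Product using (_×_; _,_; ∃; ∃-syntax)
open import Data.Sum using (_⊎_)
open import Data.List using (List; []; _∷_; _++_; [_]; length; filter; cartesianProduct; allFin)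
open import Data.List.Membership.Propositional using (_∈_)
open import Data.List.Relation.Unary.All using (All)
open import Data.List.Relation.Unary.Unique.Propositional using (Unique)
open import Data.List.Relation.Binary.Sublist.Propositional using (_⊆_)
open import Relation.Nullary using (¬_)
open import Relation.Binary.PropositionalEquality using (_≡_)

-- The 8 points of F₂³ (only the underlying 8-element set matters here).
Point : Set
Point = Fin 8

-- A line {p,q} (p ≠ q) is represented canonically by the ordered pair (p , q) with p < q.
Line : Set
Line = Point × Point

allLines : List Line
allLines = filter (λ pq → Data.Product.proj₁ pq <? Data.Product.proj₂ pq)
                  (cartesianProduct (allFin 8) (allFin 8))

-- A line complex: a set of exactly 8 distinct lines, represented canonically as a
-- sublist of allLines (so each set of lines has exactly one representative).
IsLineComplex : List Line → Set
IsLineComplex C = (C ⊆ allLines) × (length C ≡ 8)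

_on_ : Point → Line → Set
p on (a , b) = (p ≡ a) ⊎ (p ≡ b)

Omits : List Line → Point → Set
Omits C p = ∀ {l} → l ∈ C → ¬ (p on l)

OmitsNoPoint : List Line → Set
OmitsNoPoint C = ∀ p → ¬ Omits C p

Adj : List Line → Point → Point → Set
Adj C p q = ((p , q) ∈ C) ⊎ ((q , p) ∈ C)

data Reach (C : List Line) : Point → Point → Set where
  here  : ∀ {p} → Reach C p p
  there : ∀ {p q r} → Adj C p q → Reach C q r → Reach C p r

data Walk (C : List Line) : List Point → Set where
  nil  : Walk C []
  one  : ∀ {p} → Walk C [ p ]
  cons : ∀ {p q vs} → Adj C p q → Walk C (q ∷ vs) → Walk C (p ∷ q ∷ vs)

IsCycle : List Line → List Point → Set
IsCycle C [] = Data.Empty.⊥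
  where import Data.Empty
IsCycle C (v ∷ vs) = Unique (v ∷ vs) × (length vs ≥ 2) × Walk C (v ∷ vs ++ [ v ])

-- the connected component of p (vertices reachable from p, with all lines of C among
-- them) is a tree: it is connected by construction, and it contains no cycle
ComponentIsTree : List Line → Point → Set
ComponentIsTree C p = ¬ (∃[ cyc ] (IsCycle C cyc × All (Reach C p) cyc))

HasIsolatedTree : List Line → Set
HasIsolatedTree C = ∃[ l ] ((l ∈ C) × ComponentIsTree C (Data.Product.proj₁ l))

module Submission where

-- The property is decided for each set C of lines by a union–find pass over C: every point carries
-- the least point of its component as label, and a flag saying whether the component contains a
-- cycle. Adding a line ab merges the classes of a and b, and the merged component contains a cycle
-- iff one of the two did or a and b were already connected: then ab closes a cycle, and otherwise
-- ab is a bridge, which no cycle can use. C omits no point iff every point shares its label with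
-- another one, and it has an isolated tree iff some such point is unflagged.
-- The accepted 8-sets of the 28 lines are counted by a dynamic programme over the lines, keeping
-- for each pair (lines still to choose, state) the number of partial choices that reach it; it rests
-- on count (x ∷ xs) (k + 1) s = count xs k (insert s x) + count xs (k + 1) s, and evaluates to 200970.

open import Defs
open import Data.Bool using (Bool; true; false; _∨_; T; if_then_else_)
open import Data.Bool.Properties using (T-∨) renaming (_≟_ to _≟ᵇ_)
open import Data.Empty using (⊥-elim)
open import Data.Fin using (toℕ; _<_)
open import Data.Fin.Properties using (<⇒≢; <-asym; _<?_) renaming (_≟_ to _≟ᶠ_)
open import Data.List using (List; []; _∷_; _++_; [_]; _ʳ++_; length; map; filter; foldl; allFin; cartesianProduct)
open import Data.List.Membership.Propositional using (_∈_; _∉_; lose)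
open import Data.List.Membership.Propositional.Properties
  using (∈-++⁺ˡ; ∈-++⁺ʳ; ∈-++⁻; ∈-∃++; ∈-allFin; ∈-map⁺; ∈-map⁻; ∈-filter⁺; ∈-filter⁻)
open import Data.List.Membership.DecPropositional (_≟ᶠ_ {8}) using (_∈?_)
open import Data.List.Properties using (++-assoc; ++-identityʳ; length-++; ∷-injectiveʳ; filter-++; filter-accept; filter-reject)
open import Data.List.Relation.Binary.Disjoint.Propositional using (Disjoint)
open import Data.List.Relation.Binary.Permutation.Propositional using (_↭_)
import Data.List.Relation.Binary.Permutation.Propositional.Properties as ↭
open import Data.List.Relation.Binary.Sublist.Propositional using (_⊆_; []; _∷_; _∷ʳ_; minimum; lookup)
open import Data.List.Relation.Binary.Sublist.Propositional.Properties using (All-resp-⊆)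
open import Data.List.Relation.Unary.All as All using (All; []; _∷_; all?)
import Data.List.Relation.Unary.All.Properties as All
open import Data.List.Relation.Unary.AllPairs using ([]; _∷_)
open import Data.List.Relation.Unary.Any using (Any; here; there; any?; satisfied)
import Data.List.Relation.Unary.Any.Properties as Any
open import Data.List.Relation.Unary.Unique.Propositional using (Unique)
open import Data.List.Relation.Unary.Unique.Propositional.Properties using (++⁺; map⁺)
import Data.List.Relation.Unary.Unique.Propositional.Properties as Unique
open import Data.List.Relation.Unary.Unique.DecPropositional using (unique?)
open import Data.Nat using (ℕ; zero; suc; _+_; _*_; _≤ᵇ_; _≤?_; s≤s; z≤n) renaming (_≤_ to _≤ℕ_; _<_ to _<ℕ_)
open import Data.Nat.Properties using (+-monoˡ-≤; m<n⇒m<1+n; +-assoc; *-distribʳ-+; *-zeroʳ; +-identityʳ; *-identityˡ; ≰⇒>; ≤-decTotalOrder; _≟_)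
open import Data.Nat.ListAction using (sum)
open import Data.Nat.ListAction.Properties using (sum-↭)
open import Data.Nat.Solver using (module +-*-Solver)
open +-*-Solver using (solve; _:+_; _:*_; _:=_)
open import Data.Product as Product using (Σ-syntax; _×_; _,_; proj₁; proj₂; ∃-syntax; uncurry)
open import Data.Product.Properties using (≡-dec)
open import Data.Sum as Sum using (_⊎_; inj₁; inj₂; [_,_]′)
open import Data.Vec as Vec using (Vec)
import Data.Vec.Properties as Vec
open import Data.Vec.Properties using (lookup∘tabulate)
open import Function using (_∘_; id)
open import Function.Bundles using (Equivalence; _⇔_; mk⇔)
import Relation.Binary.Construct.On as On
open import Relation.Binary.PropositionalEquality using (_≡_; _≢_; refl; sym; trans; cong; cong₂; subst; ≢-sym)
open Relation.Binary.PropositionalEquality.≡-Reasoning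
open import Relation.Nullary using (¬_; Dec; yes; no; does; ¬?; _⊎-dec_; _×-dec_)
open import Relation.Nullary.Decidable using (⌊_⌋; toWitness; fromWitness)
open import Relation.Unary using (Decidable)

CycleReachable : List Line → Point → Set
CycleReachable C p = ∃[ cyc ] (IsCycle C cyc × All (Reach C p) cyc)

module _ {C : List Line} where

  Adj-sym : ∀ {p q} → Adj C p q → Adj C q p
  Adj-sym (inj₁ pq) = inj₂ pq
  Adj-sym (inj₂ qp) = inj₁ qp

  Adj⇒Reach : ∀ {p q} → Adj C p q → Reach C p q
  Adj⇒Reach pq = there pq here

  Reach-trans : ∀ {p q r} → Reach C p q → Reach C q r → Reach C p r
  Reach-trans here qr = qr
  Reach-trans (there pp′ p′q) qr = there pp′ (Reach-trans p′q qr)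

  Reach-sym : ∀ {p q} → Reach C p q → Reach C q p
  Reach-sym here = here
  Reach-sym (there pp′ p′q) = Reach-trans (Reach-sym p′q) (Adj⇒Reach (Adj-sym pp′))

  Reach⇒on : ∀ {p q} → Reach C p q → p ≢ q → ∃[ l ] (l ∈ C × p on l)
  Reach⇒on here p≢p = ⊥-elim (p≢p refl)
  Reach⇒on (there (inj₁ pq) _) _ = _ , pq , inj₁ refl
  Reach⇒on (there (inj₂ qp) _) _ = _ , qp , inj₂ refl

  CycleReachable-transfer : ∀ {u v} → Reach C u v → CycleReachable C v → CycleReachable C u
  CycleReachable-transfer uv (cyc , isCyc , reach) = cyc , isCyc , All.map (Reach-trans uv) reach

module _ {A B : List Line} (A⊆B : ∀ {l} → l ∈ A → l ∈ B) where

  Adj-mono : ∀ {p q} → Adj A p q → Adj B p q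
  Adj-mono (inj₁ pq) = inj₁ (A⊆B pq)
  Adj-mono (inj₂ qp) = inj₂ (A⊆B qp)

  Reach-mono : ∀ {p q} → Reach A p q → Reach B p q
  Reach-mono here = here
  Reach-mono (there pp′ p′q) = there (Adj-mono pp′) (Reach-mono p′q)

  Walk-mono : ∀ {vs} → Walk A vs → Walk B vs
  Walk-mono nil = nil
  Walk-mono one = one
  Walk-mono (cons pq w) = cons (Adj-mono pq) (Walk-mono w)

  IsCycle-mono : ∀ cyc → IsCycle A cyc → IsCycle B cyc
  IsCycle-mono (_ ∷ _) (distinct , long , w) = distinct , long , Walk-mono w

  CycleReachable-mono : ∀ {p} → CycleReachable A p → CycleReachable B p
  CycleReachable-mono (cyc , isCyc , reach) = cyc , IsCycle-mono cyc isCyc , All.map Reach-mono reach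

Reach-[] : ∀ {u v} → Reach [] u v → u ≡ v
Reach-[] here = refl
Reach-[] (there (inj₁ ()) _)
Reach-[] (there (inj₂ ()) _)

IsCycle-[] : ∀ cyc → ¬ IsCycle [] cyc
IsCycle-[] (_ ∷ []) (_ , () , _)
IsCycle-[] (_ ∷ _ ∷ _) (_ , _ , cons (inj₁ ()) _)
IsCycle-[] (_ ∷ _ ∷ _) (_ , _ , cons (inj₂ ()) _)

module _ {X : Set} where

  endpoint : X → List X → X
  endpoint x [] = x
  endpoint _ (y ∷ ys) = endpoint y ys

  endpoint-++ : ∀ d pre x post → endpoint d (pre ++ x ∷ post) ≡ endpoint x post
  endpoint-++ d [] x post = refl
  endpoint-++ d (p ∷ pre) x post = endpoint-++ p pre x post

  endpoint-snoc : ∀ d ys w → endpoint d (ys ++ [ w ]) ≡ w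
  endpoint-snoc d [] w = refl
  endpoint-snoc d (y ∷ ys) w = endpoint-snoc y ys w

  endpoint-∈ : ∀ d y ys → endpoint d (y ∷ ys) ∈ y ∷ ys
  endpoint-∈ d y [] = here refl
  endpoint-∈ d y (z ∷ ys) = there (endpoint-∈ y z ys)

module _ {C : List Line} where

  Walk⇒Reach-endpoint : ∀ {x ys} → Walk C (x ∷ ys) → Reach C x (endpoint x ys)
  Walk⇒Reach-endpoint {ys = []} one = here
  Walk⇒Reach-endpoint {ys = _ ∷ _} (cons xy w) = there xy (Walk⇒Reach-endpoint w)

  Walk⇒Reach-all : ∀ {x ys} → Walk C (x ∷ ys) → All (Reach C x) (x ∷ ys)
  Walk⇒Reach-all {ys = []} one = here ∷ []
  Walk⇒Reach-all {ys = _ ∷ _} (cons xy w) = here ∷ All.map (there xy) (Walk⇒Reach-all w)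

  Walk-snoc⁺ : ∀ {x ys w} → Walk C (x ∷ ys) → Adj C (endpoint x ys) w → Walk C (x ∷ ys ++ [ w ])
  Walk-snoc⁺ {ys = []} one e = cons e one
  Walk-snoc⁺ {ys = _ ∷ _} (cons xy wk) e = cons xy (Walk-snoc⁺ wk e)

  Walk-snoc⁻ : ∀ {x ys w} → Walk C (x ∷ ys ++ [ w ]) → Walk C (x ∷ ys) × Adj C (endpoint x ys) w
  Walk-snoc⁻ {ys = []} (cons e one) = one , e
  Walk-snoc⁻ {ys = _ ∷ ys} (cons xy wk) with Walk-snoc⁻ {ys = ys} wk
  ... | wk′ , e = cons xy wk′ , e

  Walk-suffix : ∀ pre {x post} → Walk C (pre ++ x ∷ post) → Walk C (x ∷ post)
  Walk-suffix [] w = w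
  Walk-suffix (_ ∷ []) (cons _ w) = w
  Walk-suffix (_ ∷ q ∷ pre) (cons _ w) = Walk-suffix (q ∷ pre) w

  IsCycle⇒Reach-all : ∀ {x xs} → IsCycle C (x ∷ xs) → All (Reach C x) (x ∷ xs)
  IsCycle⇒Reach-all {xs = xs} (_ , _ , w) with Walk⇒Reach-all w
  ... | x↝x ∷ x↝rest = x↝x ∷ All.++⁻ˡ xs x↝rest

module _ {X : Set} where

  Unique-suffix : ∀ pre {xs : List X} → Unique (pre ++ xs) → Unique xs
  Unique-suffix [] u = u
  Unique-suffix (_ ∷ pre) (_ ∷ u) = Unique-suffix pre u

  Unique-cons : ∀ {x : X} {xs} → x ∉ xs → Unique xs → Unique (x ∷ xs)
  Unique-cons x∉xs u = All.¬Any⇒All¬ _ x∉xs ∷ u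

  Unique-rotate₁ : ∀ (a : X) xs → Unique (a ∷ xs) → Unique (xs ++ [ a ])
  Unique-rotate₁ a [] _ = [] ∷ []
  Unique-rotate₁ a (x ∷ xs) ((a≢x ∷ a∉xs) ∷ (x∉xs ∷ u)) =
    All.++⁺ x∉xs (≢-sym a≢x ∷ []) ∷ Unique-rotate₁ a xs (a∉xs ∷ u)

SimplePath : List Line → Point → Point → Set
SimplePath C u w = ∃[ ps ] (Unique (u ∷ ps) × Walk C (u ∷ ps) × endpoint u ps ≡ w)

-- Loop erasure: if u already lies on the simple path from q, cut that path back to u.
Reach⇒SimplePath : ∀ {C u w} → Reach C u w → SimplePath C u w
Reach⇒SimplePath here = [] , [] ∷ [] , one , refl
Reach⇒SimplePath {u = u} (there {q = q} uq qw) with Reach⇒SimplePath qw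
... | qs , distinct , walk , ends with u ∈? (q ∷ qs)
...   | no u∉ = q ∷ qs , Unique-cons u∉ distinct , cons uq walk , ends
...   | yes u∈ with ∈-∃++ u∈
...     | pre , post , split =
  post ,
  Unique-suffix pre (subst Unique split distinct) ,
  Walk-suffix pre (subst (Walk _) split walk) ,
  trans (sym (endpoint-++ u pre u post)) (trans (cong (endpoint u) (sym split)) ends)

IsCycle-rotate₁ : ∀ {C} a vs → IsCycle C (a ∷ vs) → IsCycle C (vs ++ [ a ])
IsCycle-rotate₁ a [] (_ , () , _)
IsCycle-rotate₁ a (w ∷ ws) (distinct , s≤s long , cons aw walk) =
  Unique-rotate₁ a (w ∷ ws) distinct ,
  subst (2 ≤ℕ_) (sym (length-++ ws)) (+-monoˡ-≤ 1 long) ,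
  Walk-snoc⁺ walk (subst (λ z → Adj _ z w) (sym (endpoint-snoc w ws a)) aw)

IsCycle-rotate : ∀ {C} as x bs → IsCycle C (as ++ x ∷ bs) → IsCycle C (x ∷ bs ++ as)
IsCycle-rotate {C} [] x bs cyc = subst (λ z → IsCycle C (x ∷ z)) (sym (++-identityʳ bs)) cyc
IsCycle-rotate {C} (a ∷ as) x bs cyc =
  subst (λ z → IsCycle C (x ∷ z)) (++-assoc bs [ a ] as)
    (IsCycle-rotate as x (bs ++ [ a ])
      (subst (IsCycle C) (++-assoc as (x ∷ bs) [ a ]) (IsCycle-rotate₁ a (as ++ x ∷ bs) cyc)))

module AddEdge (a b : Point) (A : List Line) where

  A⁺ : List Line
  A⁺ = (a , b) ∷ A

  newEdge : Adj A⁺ a b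
  newEdge = inj₁ (here refl)

  Adj-split : ∀ {u q} → Adj A⁺ u q → Adj A u q ⊎ (u ≡ a × q ≡ b) ⊎ (u ≡ b × q ≡ a)
  Adj-split (inj₁ (here refl)) = inj₂ (inj₁ (refl , refl))
  Adj-split (inj₂ (here refl)) = inj₂ (inj₂ (refl , refl))
  Adj-split (inj₁ (there uq)) = inj₁ (inj₁ uq)
  Adj-split (inj₂ (there qu)) = inj₁ (inj₂ qu)

  Split : Point → Point → Set
  Split u v = Reach A u v ⊎ (Reach A u a × Reach A b v) ⊎ (Reach A u b × Reach A a v)

  Reach-split : ∀ {u v} → Reach A⁺ u v → Split u v
  Reach-split here = inj₁ here
  Reach-split (there e r) with Adj-split e | Reach-split r
  ... | inj₁ uq | inj₁ qv = inj₁ (there uq qv)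
  ... | inj₁ uq | inj₂ (inj₁ (qa , bv)) = inj₂ (inj₁ (there uq qa , bv))
  ... | inj₁ uq | inj₂ (inj₂ (qb , av)) = inj₂ (inj₂ (there uq qb , av))
  ... | inj₂ (inj₁ (refl , refl)) | inj₁ bv = inj₂ (inj₁ (here , bv))
  ... | inj₂ (inj₁ (refl , refl)) | inj₂ (inj₁ (ba , bv)) = inj₁ (Reach-trans (Reach-sym ba) bv)
  ... | inj₂ (inj₁ (refl , refl)) | inj₂ (inj₂ (_ , av)) = inj₁ av
  ... | inj₂ (inj₂ (refl , refl)) | inj₁ av = inj₂ (inj₂ (here , av))
  ... | inj₂ (inj₂ (refl , refl)) | inj₂ (inj₁ (_ , bv)) = inj₁ bv
  ... | inj₂ (inj₂ (refl , refl)) | inj₂ (inj₂ (ab , av)) = inj₁ (Reach-trans (Reach-sym ab) av)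

  Walk-avoiding : ∀ {ws} → All (_≢ a) ws → Walk A⁺ ws → Walk A ws
  Walk-avoiding _ nil = nil
  Walk-avoiding _ one = one
  Walk-avoiding (p≢a ∷ rest) (cons e w) with Adj-split e
  ... | inj₁ pq = cons pq (Walk-avoiding rest w)
  ... | inj₂ (inj₁ (p≡a , _)) = ⊥-elim (p≢a p≡a)
  ... | inj₂ (inj₂ (_ , q≡a)) = ⊥-elim (All.head rest q≡a)

  IsCycle-avoiding : ∀ cyc → All (_≢ a) cyc → IsCycle A⁺ cyc → IsCycle A cyc
  IsCycle-avoiding (c ∷ cs) avoid (distinct , long , w) =
    distinct , long , Walk-avoiding (All.++⁺ avoid (All.head avoid ∷ [])) w

  Adj-from-a : ∀ {x} → Adj A⁺ a x → x ≢ a → Adj A a x ⊎ x ≡ b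
  Adj-from-a e x≢a with Adj-split e
  ... | inj₁ ax = inj₁ ax
  ... | inj₂ (inj₁ (_ , x≡b)) = inj₂ x≡b
  ... | inj₂ (inj₂ (_ , x≡a)) = ⊥-elim (x≢a x≡a)

  -- The inner arc of the cycle avoids a, so if an end of it used the new edge, it would connect b to a in A.
  IsCycle-bridge : ¬ Reach A a b → ∀ xs → IsCycle A⁺ (a ∷ xs) → IsCycle A (a ∷ xs)
  IsCycle-bridge _ [] (_ , () , _)
  IsCycle-bridge _ (_ ∷ []) (_ , s≤s () , _)
  IsCycle-bridge a↛b (x ∷ y ∷ ys) (distinct@((a≢x ∷ a∉) ∷ x∉ ∷ _) , long , cons ax closed)
    with Walk-snoc⁻ {ys = y ∷ ys} closed
  ... | arc , za = close (Adj-from-a ax (≢-sym a≢x)) (Adj-from-a (Adj-sym za) z≢a) (Walk-avoiding inner≢a arc)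
    where
    z : Point
    z = endpoint x (y ∷ ys)
    inner≢a : All (_≢ a) (x ∷ y ∷ ys)
    inner≢a = All.map ≢-sym (a≢x ∷ a∉)
    z≢a : z ≢ a
    z≢a = All.lookup inner≢a (there (endpoint-∈ x y ys))
    close : Adj A a x ⊎ x ≡ b → Adj A a z ⊎ z ≡ b → Walk A (x ∷ y ∷ ys) → IsCycle A (a ∷ x ∷ y ∷ ys)
    close (inj₁ ax′) (inj₁ az) arcA = distinct , long , cons ax′ (Walk-snoc⁺ arcA (Adj-sym az))
    close (inj₁ ax′) (inj₂ z≡b) arcA = ⊥-elim (a↛b (subst (Reach A a) z≡b (there ax′ (Walk⇒Reach-endpoint arcA))))
    close (inj₂ x≡b) (inj₁ az) arcA =
      ⊥-elim (a↛b (subst (Reach A a) x≡b (Reach-sym (Reach-trans (Walk⇒Reach-endpoint arcA) (Adj⇒Reach (Adj-sym az))))))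
    close (inj₂ x≡b) (inj₂ z≡b) _ = ⊥-elim (All.lookup x∉ (endpoint-∈ x y ys) (trans x≡b (sym z≡b)))

  CycleReachable-closing : a ≢ b → ¬ Adj A a b → Reach A a b → CycleReachable A⁺ a
  CycleReachable-closing a≢b ¬ab a↝b with Reach⇒SimplePath a↝b
  ... | [] , _ , _ , a≡b = ⊥-elim (a≢b a≡b)
  ... | _ ∷ [] , _ , cons ax one , x≡b = ⊥-elim (¬ab (subst (Adj A a) x≡b ax))
  ... | p ∷ q ∷ ps , distinct , path , ends = cyc , isCycle , IsCycle⇒Reach-all isCycle
    where
    cyc : List Point
    cyc = a ∷ p ∷ q ∷ ps
    isCycle : IsCycle A⁺ cyc
    isCycle = distinct , s≤s (s≤s z≤n) ,
              Walk-snoc⁺ (Walk-mono there path) (subst (λ t → Adj A⁺ t a) (sym ends) (Adj-sym newEdge))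

  CycleReachable-away : ∀ {v} → ¬ Reach A v a → ¬ Reach A v b → CycleReachable A⁺ v → CycleReachable A v
  CycleReachable-away {v} v↛a v↛b (cyc , isCycle , reach) =
    cyc , IsCycle-avoiding cyc (All.map (λ vc c≡a → v↛a (subst (Reach A v) c≡a vc)) reachA) isCycle , reachA
    where
    old : ∀ {x} → Reach A⁺ v x → Reach A v x
    old r with Reach-split r
    ... | inj₁ vx = vx
    ... | inj₂ (inj₁ (va , _)) = ⊥-elim (v↛a va)
    ... | inj₂ (inj₂ (vb , _)) = ⊥-elim (v↛b vb)
    reachA : All (Reach A v) cyc
    reachA = All.map old reach

  CycleReachable-across : ¬ Reach A a b → ∀ {v} → CycleReachable A⁺ v →
                          CycleReachable A v ⊎ CycleReachable A a ⊎ CycleReachable A b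
  CycleReachable-across a↛b (cyc , isCycle , reach) with a ∈? cyc
  ... | yes a∈ with ∈-∃++ a∈
  ...   | pre , post , refl =
    let isCycleA = IsCycle-bridge a↛b (post ++ pre) (IsCycle-rotate pre a post isCycle)
    in inj₂ (inj₁ (a ∷ post ++ pre , isCycleA , IsCycle⇒Reach-all isCycleA))
  CycleReachable-across _ {v} (c ∷ cs , isCycle , vc ∷ _) | no a∉ = via (Reach-split vc)
    where
    isCycleA : IsCycle A (c ∷ cs)
    isCycleA = IsCycle-avoiding (c ∷ cs) (All.map ≢-sym (All.¬Any⇒All¬ _ a∉)) isCycle
    from : ∀ {w} → Reach A w c → CycleReachable A w
    from wc = c ∷ cs , isCycleA , All.map (Reach-trans wc) (IsCycle⇒Reach-all isCycleA)
    via : Split v c → CycleReachable A v ⊎ CycleReachable A a ⊎ CycleReachable A b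
    via (inj₁ vc′) = inj₁ (from vc′)
    via (inj₂ (inj₁ (_ , bc))) = inj₂ (inj₂ (from bc))
    via (inj₂ (inj₂ (_ , ac))) = inj₂ (inj₁ (from ac))

if-dec-yes : ∀ {P X : Set} (d : Dec P) {x y : X} → P → (if does d then x else y) ≡ x
if-dec-yes (yes _) _ = refl
if-dec-yes (no ¬p) p = ⊥-elim (¬p p)

if-dec-no : ∀ {P X : Set} (d : Dec P) {x y : X} → ¬ P → (if does d then x else y) ≡ y
if-dec-no (yes p) ¬p = ⊥-elim (¬p p)
if-dec-no (no _) _ = refl

-- A state labels every point by a representative of its component and flags the components containing a cycle.
State : Set
State = Vec Point 8 × Vec Bool 8

label : State → Point → Point
label (labels , _) = Vec.lookup labels

cyclic : State → Point → Bool
cyclic (_ , flags) = Vec.lookup flags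

discrete : State
discrete = Vec.tabulate id , Vec.tabulate (λ _ → false)

smaller : Point → Point → Point
smaller x y = if toℕ x ≤ᵇ toℕ y then x else y

smaller-sel : ∀ x y → smaller x y ≡ x ⊎ smaller x y ≡ y
smaller-sel x y with toℕ x ≤ᵇ toℕ y
... | true = inj₁ refl
... | false = inj₂ refl

module _ (s : State) (a b : Point) where

  Merged : Point → Set
  Merged v = label s v ≡ label s a ⊎ label s v ≡ label s b

  merged? : Decidable Merged
  merged? v = (label s v ≟ᶠ label s a) ⊎-dec (label s v ≟ᶠ label s b)

  mergedLabel : Point
  mergedLabel = smaller (label s a) (label s b)

  mergedCyclic : Bool
  mergedCyclic = cyclic s a ∨ cyclic s b ∨ ⌊ label s a ≟ᶠ label s b ⌋

  mergedCyclic⁻ : T mergedCyclic → T (cyclic s a) ⊎ T (cyclic s b) ⊎ label s a ≡ label s b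
  mergedCyclic⁻ c with Equivalence.to (T-∨ {cyclic s a}) c
  ... | inj₁ ca = inj₁ ca
  ... | inj₂ rest = inj₂ (Sum.map₂ toWitness (Equivalence.to (T-∨ {cyclic s b}) rest))

  mergedCyclic⁺ : T (cyclic s a) ⊎ T (cyclic s b) ⊎ label s a ≡ label s b → T mergedCyclic
  mergedCyclic⁺ c = Equivalence.from (T-∨ {cyclic s a}) (Sum.map₂ (Equivalence.from (T-∨ {cyclic s b}) ∘ Sum.map₂ fromWitness) c)

  relabel : Point → Point
  relabel v = if does (merged? v) then mergedLabel else label s v

  reflag : Point → Bool
  reflag v = if does (merged? v) then mergedCyclic else cyclic s v

-- Labels stay the least point of each component, so the state depends only on the graph and the
-- count below can merge equal states.
insert : State → Line → State
insert s (a , b) = Vec.tabulate (relabel s a b) , Vec.tabulate (reflag s a b)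

module _ (s : State) (a b : Point) {v : Point} where

  label-insert-merged : Merged s a b v → label (insert s (a , b)) v ≡ mergedLabel s a b
  label-insert-merged m = trans (lookup∘tabulate (relabel s a b) v) (if-dec-yes (merged? s a b v) m)

  label-insert-unmerged : ¬ Merged s a b v → label (insert s (a , b)) v ≡ label s v
  label-insert-unmerged ¬m = trans (lookup∘tabulate (relabel s a b) v) (if-dec-no (merged? s a b v) ¬m)

  cyclic-insert-merged : Merged s a b v → cyclic (insert s (a , b)) v ≡ mergedCyclic s a b
  cyclic-insert-merged m = trans (lookup∘tabulate (reflag s a b) v) (if-dec-yes (merged? s a b v) m)

  cyclic-insert-unmerged : ¬ Merged s a b v → cyclic (insert s (a , b)) v ≡ cyclic s v
  cyclic-insert-unmerged ¬m = trans (lookup∘tabulate (reflag s a b) v) (if-dec-no (merged? s a b v) ¬m)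

  mergedLabel⇒Merged : label s v ≡ mergedLabel s a b → Merged s a b v
  mergedLabel⇒Merged eq with smaller-sel (label s a) (label s b)
  ... | inj₁ isA = inj₁ (trans eq isA)
  ... | inj₂ isB = inj₂ (trans eq isB)

record Tracks (A : List Line) (s : State) : Set where
  field
    label≡⇒Reach : ∀ u v → label s u ≡ label s v → Reach A u v
    Reach⇒label≡ : ∀ u v → Reach A u v → label s u ≡ label s v
    cyclic⇒CycleReachable : ∀ v → T (cyclic s v) → CycleReachable A v
    CycleReachable⇒cyclic : ∀ v → CycleReachable A v → T (cyclic s v)

module _ {A : List Line} {s : State} (tracks : Tracks A s) {a b : Point} (a≢b : a ≢ b) (¬ab : ¬ Adj A a b) where
  open Tracks tracks
  open AddEdge a b A

  private
    s′ : State
    s′ = insert s (a , b)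
    la lb : Point
    la = label s a
    lb = label s b

    Merged⇒Reach-a : ∀ v → Merged s a b v → Reach A⁺ v a
    Merged⇒Reach-a v (inj₁ isA) = Reach-mono there (label≡⇒Reach v a isA)
    Merged⇒Reach-a v (inj₂ isB) = Reach-trans (Reach-mono there (label≡⇒Reach v b isB)) (Adj⇒Reach (Adj-sym newEdge))

    Merged-resp : ∀ {u v} → label s u ≡ label s v → Merged s a b u → Merged s a b v
    Merged-resp u≡v (inj₁ isA) = inj₁ (trans (sym u≡v) isA)
    Merged-resp u≡v (inj₂ isB) = inj₂ (trans (sym u≡v) isB)

    unmerged-label : ∀ {u v} → Merged s a b u → ¬ Merged s a b v → label s′ u ≢ label s′ v
    unmerged-label {u} {v} mu ¬mv eq =
      ¬mv (mergedLabel⇒Merged s a b (trans (sym (label-insert-unmerged s a b ¬mv))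
                                      (trans (sym eq) (label-insert-merged s a b mu))))

    label≡⇒Reach′ : ∀ u v → label s′ u ≡ label s′ v → Reach A⁺ u v
    label≡⇒Reach′ u v eq with merged? s a b u | merged? s a b v
    ... | yes mu | yes mv = Reach-trans (Merged⇒Reach-a u mu) (Reach-sym (Merged⇒Reach-a v mv))
    ... | yes mu | no ¬mv = ⊥-elim (unmerged-label mu ¬mv eq)
    ... | no ¬mu | yes mv = ⊥-elim (unmerged-label mv ¬mu (sym eq))
    ... | no ¬mu | no ¬mv =
      Reach-mono there (label≡⇒Reach u v (trans (sym (label-insert-unmerged s a b ¬mu))
                                           (trans eq (label-insert-unmerged s a b ¬mv))))

    both-merged : ∀ u v → Merged s a b u → Merged s a b v → label s′ u ≡ label s′ v
    both-merged u v mu mv = trans (label-insert-merged s a b mu) (sym (label-insert-merged s a b mv))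

    Reach⇒label≡′ : ∀ u v → Reach A⁺ u v → label s′ u ≡ label s′ v
    Reach⇒label≡′ u v r with Reach-split r
    ... | inj₂ (inj₁ (ua , bv)) = both-merged u v (inj₁ (Reach⇒label≡ u a ua)) (inj₂ (sym (Reach⇒label≡ b v bv)))
    ... | inj₂ (inj₂ (ub , av)) = both-merged u v (inj₂ (Reach⇒label≡ u b ub)) (inj₁ (sym (Reach⇒label≡ a v av)))
    ... | inj₁ uv with Reach⇒label≡ u v uv | merged? s a b u
    ...   | u≡v | yes mu = both-merged u v mu (Merged-resp u≡v mu)
    ...   | u≡v | no ¬mu =
      trans (label-insert-unmerged s a b ¬mu)
            (trans u≡v (sym (label-insert-unmerged s a b (¬mu ∘ Merged-resp (sym u≡v)))))

    cyclic⇒CycleReachable′ : ∀ v → T (cyclic s′ v) → CycleReachable A⁺ v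
    cyclic⇒CycleReachable′ v cv with merged? s a b v
    ... | no ¬mv = CycleReachable-mono there (cyclic⇒CycleReachable v (subst T (cyclic-insert-unmerged s a b ¬mv) cv))
    ... | yes mv = CycleReachable-transfer (Merged⇒Reach-a v mv)
                     (from-a (mergedCyclic⁻ s a b (subst T (cyclic-insert-merged s a b mv) cv)))
      where
      from-a : T (cyclic s a) ⊎ T (cyclic s b) ⊎ la ≡ lb → CycleReachable A⁺ a
      from-a (inj₁ ca) = CycleReachable-mono there (cyclic⇒CycleReachable a ca)
      from-a (inj₂ (inj₁ cb)) = CycleReachable-transfer (Adj⇒Reach newEdge) (CycleReachable-mono there (cyclic⇒CycleReachable b cb))
      from-a (inj₂ (inj₂ la≡lb)) = CycleReachable-closing a≢b ¬ab (label≡⇒Reach a b la≡lb)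

    CycleReachable⇒cyclic′ : ∀ v → CycleReachable A⁺ v → T (cyclic s′ v)
    CycleReachable⇒cyclic′ v cr with merged? s a b v
    ... | no ¬mv = subst T (sym (cyclic-insert-unmerged s a b ¬mv))
                     (CycleReachable⇒cyclic v (CycleReachable-away (¬mv ∘ inj₁ ∘ Reach⇒label≡ v a) (¬mv ∘ inj₂ ∘ Reach⇒label≡ v b) cr))
    ... | yes mv = subst T (sym (cyclic-insert-merged s a b mv)) (mergedCyclic⁺ s a b cases)
      where
      cases : T (cyclic s a) ⊎ T (cyclic s b) ⊎ la ≡ lb
      cases with la ≟ᶠ lb
      ... | yes la≡lb = inj₂ (inj₂ la≡lb)
      ... | no la≢lb with CycleReachable-across (la≢lb ∘ Reach⇒label≡ a b) cr
      ...   | inj₂ (inj₁ ca) = inj₁ (CycleReachable⇒cyclic a ca)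
      ...   | inj₂ (inj₂ cb) = inj₂ (inj₁ (CycleReachable⇒cyclic b cb))
      ...   | inj₁ cv = via mv
        where
        via : Merged s a b v → T (cyclic s a) ⊎ T (cyclic s b) ⊎ la ≡ lb
        via (inj₁ isA) = inj₁ (CycleReachable⇒cyclic a (CycleReachable-transfer (label≡⇒Reach a v (sym isA)) cv))
        via (inj₂ isB) = inj₂ (inj₁ (CycleReachable⇒cyclic b (CycleReachable-transfer (label≡⇒Reach b v (sym isB)) cv)))

  Tracks-insert : Tracks A⁺ s′
  Tracks-insert = record
    { label≡⇒Reach = label≡⇒Reach′
    ; Reach⇒label≡ = Reach⇒label≡′
    ; cyclic⇒CycleReachable = cyclic⇒CycleReachable′
    ; CycleReachable⇒cyclic = CycleReachable⇒cyclic′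
    }

run : State → List Line → State
run = foldl insert

Tracks-discrete : Tracks [] discrete
Tracks-discrete = record
  { label≡⇒Reach = λ u v eq → subst (Reach [] u) (trans (sym (lookup∘tabulate id u)) (trans eq (lookup∘tabulate id v))) here
  ; Reach⇒label≡ = λ u v uv → cong (label discrete) (Reach-[] uv)
  ; cyclic⇒CycleReachable = λ v cv → ⊥-elim (subst T (lookup∘tabulate (λ _ → false) v) cv)
  ; CycleReachable⇒cyclic = λ v (cyc , isCycle , _) → ⊥-elim (IsCycle-[] cyc isCycle)
  }

Tracks-resp : ∀ {A B s} → (∀ {l} → l ∈ A → l ∈ B) → (∀ {l} → l ∈ B → l ∈ A) → Tracks A s → Tracks B s
Tracks-resp A⊆B B⊆A tracks = record
  { label≡⇒Reach = λ u v eq → Reach-mono A⊆B (label≡⇒Reach u v eq)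
  ; Reach⇒label≡ = λ u v uv → Reach⇒label≡ u v (Reach-mono B⊆A uv)
  ; cyclic⇒CycleReachable = λ v cv → CycleReachable-mono A⊆B (cyclic⇒CycleReachable v cv)
  ; CycleReachable⇒cyclic = λ v cr → CycleReachable⇒cyclic v (CycleReachable-mono B⊆A cr)
  }
  where open Tracks tracks

Ordered : Line → Set
Ordered l = proj₁ l < proj₂ l

Tracks-run : ∀ Q {A s} → Tracks A s → All Ordered A → All Ordered Q → Unique Q → Disjoint Q A →
             Tracks (Q ʳ++ A) (run s Q)
Tracks-run [] tracks _ _ _ _ = tracks
Tracks-run ((a , b) ∷ Q) {A} tracks ordA (a<b ∷ ordQ) (ab∉Q ∷ uniqueQ) disjoint =
  Tracks-run Q (Tracks-insert tracks (<⇒≢ a<b) ¬ab) (a<b ∷ ordA) ordQ uniqueQ disjoint′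
  where
  ¬ab : ¬ Adj A a b
  ¬ab (inj₁ ab∈A) = disjoint (here refl , ab∈A)
  ¬ab (inj₂ ba∈A) = <-asym a<b (All.lookup ordA ba∈A)
  disjoint′ : Disjoint Q ((a , b) ∷ A)
  disjoint′ (l∈Q , here refl) = All.lookup ab∉Q l∈Q refl
  disjoint′ (l∈Q , there l∈A) = disjoint (there l∈Q , l∈A)

Tracks-run-discrete : ∀ {C} → All Ordered C → Unique C → Tracks C (run discrete C)
Tracks-run-discrete {C} ordC uniqueC =
  Tracks-resp (λ l∈ → [ (λ ()) , id ]′ (Any.reverseAcc⁻ [] C l∈)) (λ l∈ → Any.reverseAcc⁺ [] C (inj₂ l∈))
    (Tracks-run C Tracks-discrete [] ordC uniqueC (λ ()))

Covered : State → Point → Set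
Covered s v = Any (λ u → u ≢ v × label s u ≡ label s v) (allFin 8)

covered? : ∀ s → Decidable (Covered s)
covered? s v = any? (λ u → ¬? (u ≟ᶠ v) ×-dec (label s u ≟ᶠ label s v)) (allFin 8)

Accepts : State → Set
Accepts s = All (Covered s) (allFin 8) × Any (λ v → Covered s v × cyclic s v ≡ false) (allFin 8)

accepts? : Decidable Accepts
accepts? s = all? (covered? s) (allFin 8) ×-dec any? (λ v → covered? s v ×-dec (cyclic s v ≟ᵇ false)) (allFin 8)

on⇒Reach : ∀ {C l v} → l ∈ C → v on l → Reach C (proj₁ l) v
on⇒Reach _ (inj₁ refl) = here
on⇒Reach l∈C (inj₂ refl) = Adj⇒Reach (inj₁ l∈C)

module _ {C : List Line} {s : State} (tracks : Tracks C s) (ordC : All Ordered C) where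
  open Tracks tracks

  Covered⇒on : ∀ {v} → Covered s v → ∃[ l ] (l ∈ C × v on l)
  Covered⇒on {v} covered with satisfied covered
  ... | u , u≢v , same = Reach⇒on (Reach-sym (label≡⇒Reach u v same)) (≢-sym u≢v)

  on⇒Covered : ∀ {l v} → l ∈ C → v on l → Covered s v
  on⇒Covered {p , q} p<q∈C (inj₁ refl) =
    lose (∈-allFin q) (≢-sym (<⇒≢ (All.lookup ordC p<q∈C)) , Reach⇒label≡ q p (Adj⇒Reach (inj₂ p<q∈C)))
  on⇒Covered {p , q} p<q∈C (inj₂ refl) =
    lose (∈-allFin p) (<⇒≢ (All.lookup ordC p<q∈C) , Reach⇒label≡ p q (Adj⇒Reach (inj₁ p<q∈C)))

  acyclic⇒tree : ∀ {v} → cyclic s v ≡ false → ComponentIsTree C v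
  acyclic⇒tree {v} acyclic cr = subst T acyclic (CycleReachable⇒cyclic v cr)

  tree⇒acyclic : ∀ {v} → ComponentIsTree C v → cyclic s v ≡ false
  tree⇒acyclic {v} tree with cyclic s v in c
  ... | false = refl
  ... | true = ⊥-elim (tree (cyclic⇒CycleReachable v (subst T (sym c) _)))

  Accepts⇒ : Accepts s → OmitsNoPoint C × HasIsolatedTree C
  Accepts⇒ (allCovered , someAcyclic) = omitsNone , isolatedTree
    where
    omitsNone : OmitsNoPoint C
    omitsNone p omits with Covered⇒on (All.lookup allCovered (∈-allFin p))
    ... | _ , l∈C , p-on = omits l∈C p-on
    isolatedTree : HasIsolatedTree C
    isolatedTree with satisfied someAcyclic
    ... | v , covered , acyclic with Covered⇒on covered
    ...   | l , l∈C , v-on = l , l∈C , λ cr → acyclic⇒tree acyclic (CycleReachable-transfer (Reach-sym (on⇒Reach l∈C v-on)) cr)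

  ⇒Accepts : OmitsNoPoint C → HasIsolatedTree C → Accepts s
  ⇒Accepts omitsNone ((p , q) , l∈C , tree) =
    All.tabulate (λ {v} _ → covered v) ,
    lose (∈-allFin p) (on⇒Covered l∈C (inj₁ refl) , tree⇒acyclic tree)
    where
    covered : ∀ v → Covered s v
    covered v with covered? s v
    ... | yes c = c
    ... | no ¬c = ⊥-elim (omitsNone v (λ l∈ v-on → ¬c (on⇒Covered l∈ v-on)))

  Accepts⇔ : Accepts s ⇔ (OmitsNoPoint C × HasIsolatedTree C)
  Accepts⇔ = mk⇔ Accepts⇒ (uncurry ⇒Accepts)

module _ {X : Set} where

  sublistsOfLength : ℕ → List X → List (List X)
  sublistsOfLength zero _ = [ [] ]
  sublistsOfLength (suc k) [] = []
  sublistsOfLength (suc k) (x ∷ xs) = map (x ∷_) (sublistsOfLength k xs) ++ sublistsOfLength (suc k) xs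

  ∈-sublistsOfLength⁻ : ∀ k xs {ys} → ys ∈ sublistsOfLength k xs → ys ⊆ xs × length ys ≡ k
  ∈-sublistsOfLength⁻ zero xs (here refl) = minimum xs , refl
  ∈-sublistsOfLength⁻ (suc k) (x ∷ xs) ys∈ with ∈-++⁻ (map (x ∷_) (sublistsOfLength k xs)) ys∈
  ... | inj₁ x∷zs∈ with ∈-map⁻ (x ∷_) x∷zs∈
  ...   | zs , zs∈ , refl = Product.map (refl ∷_) (cong suc) (∈-sublistsOfLength⁻ k xs zs∈)
  ∈-sublistsOfLength⁻ (suc k) (x ∷ xs) ys∈ | inj₂ ys∈′ =
    Product.map₁ (x ∷ʳ_) (∈-sublistsOfLength⁻ (suc k) xs ys∈′)

  ∈-sublistsOfLength⁺ : ∀ {ys xs} → ys ⊆ xs → ys ∈ sublistsOfLength (length ys) xs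
  ∈-sublistsOfLength⁺ [] = here refl
  ∈-sublistsOfLength⁺ {[]} (_ ∷ʳ _) = here refl
  ∈-sublistsOfLength⁺ {_ ∷ ys} {x ∷ xs} (_ ∷ʳ sub) =
    ∈-++⁺ʳ (map (x ∷_) (sublistsOfLength (length ys) xs)) (∈-sublistsOfLength⁺ sub)
  ∈-sublistsOfLength⁺ (refl ∷ sub) = ∈-++⁺ˡ (∈-map⁺ _ (∈-sublistsOfLength⁺ sub))

  Unique-⊆ : ∀ {ys xs : List X} → ys ⊆ xs → Unique xs → Unique ys
  Unique-⊆ [] _ = []
  Unique-⊆ (_ ∷ʳ sub) (_ ∷ unique) = Unique-⊆ sub unique
  Unique-⊆ (refl ∷ sub) (x∉ ∷ unique) = All-resp-⊆ sub x∉ ∷ Unique-⊆ sub unique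

  sublistsOfLength-unique : ∀ k {xs} → Unique xs → Unique (sublistsOfLength k xs)
  sublistsOfLength-unique zero _ = [] ∷ []
  sublistsOfLength-unique (suc k) {[]} _ = []
  sublistsOfLength-unique (suc k) {x ∷ xs} (x∉ ∷ unique) =
    ++⁺ (map⁺ ∷-injectiveʳ (sublistsOfLength-unique k unique)) (sublistsOfLength-unique (suc k) unique) disjoint
    where
    disjoint : Disjoint (map (x ∷_) (sublistsOfLength k xs)) (sublistsOfLength (suc k) xs)
    disjoint (x∷zs∈ , x∷zs∈′) with ∈-map⁻ (x ∷_) x∷zs∈
    ... | _ , _ , refl = All.lookup x∉ (lookup (proj₁ (∈-sublistsOfLength⁻ (suc k) xs x∷zs∈′)) (here refl)) refl

  sublistsOfLength-short : ∀ k xs → length xs <ℕ k → sublistsOfLength k xs ≡ []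
  sublistsOfLength-short (suc k) [] _ = refl
  sublistsOfLength-short (suc k) (x ∷ xs) (s≤s short) =
    cong₂ (λ l r → map (x ∷_) l ++ r) (sublistsOfLength-short k xs short)
          (sublistsOfLength-short (suc k) xs (m<n⇒m<1+n short))

length-filter-map : ∀ {X Y : Set} {P : Y → Set} (P? : Decidable P) (f : X → Y) xs →
                    length (filter P? (map f xs)) ≡ length (filter (P? ∘ f) xs)
length-filter-map P? f [] = refl
length-filter-map P? f (x ∷ xs) with does (P? (f x))
... | true = cong suc (length-filter-map P? f xs)
... | false = length-filter-map P? f xs

accepted : List Line → ℕ → State → List (List Line)
accepted xs k s = filter (accepts? ∘ run s) (sublistsOfLength k xs)

∈-accepted⁻ : ∀ xs k s {C} → C ∈ accepted xs k s → C ∈ sublistsOfLength k xs × Accepts (run s C)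
∈-accepted⁻ xs k s = ∈-filter⁻ (accepts? ∘ run s)

∈-accepted⁺ : ∀ xs k s {C} → C ∈ sublistsOfLength k xs → Accepts (run s C) → C ∈ accepted xs k s
∈-accepted⁺ xs k s = ∈-filter⁺ (accepts? ∘ run s)

accepted-unique : ∀ xs k s → Unique xs → Unique (accepted xs k s)
accepted-unique xs k s unique = Unique.filter⁺ (accepts? ∘ run s) (sublistsOfLength-unique k unique)

count : List Line → ℕ → State → ℕ
count xs k s = length (accepted xs k s)

count-∷ : ∀ x xs k s → count (x ∷ xs) (suc k) s ≡ count xs k (insert s x) + count xs (suc k) s
count-∷ x xs k s = begin
  length (filter P? (map (x ∷_) (sublistsOfLength k xs) ++ sublistsOfLength (suc k) xs))
    ≡⟨ cong length (filter-++ P? (map (x ∷_) (sublistsOfLength k xs)) _) ⟩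
  length (filter P? (map (x ∷_) (sublistsOfLength k xs)) ++ filter P? (sublistsOfLength (suc k) xs))
    ≡⟨ length-++ (filter P? (map (x ∷_) (sublistsOfLength k xs))) ⟩
  length (filter P? (map (x ∷_) (sublistsOfLength k xs))) + count xs (suc k) s
    ≡⟨ cong (_+ count xs (suc k) s) (length-filter-map P? (x ∷_) (sublistsOfLength k xs)) ⟩
  count xs k (insert s x) + count xs (suc k) s ∎
  where
  P? : Decidable (Accepts ∘ run s)
  P? = accepts? ∘ run s

count-short : ∀ xs k s → length xs <ℕ k → count xs k s ≡ 0
count-short xs k s short = cong (length ∘ filter (accepts? ∘ run s)) (sublistsOfLength-short k xs short)

-- An entry stands for multiplicity partial choices that have reached state and still have to pick size
-- of the remaining lines. key caches encode size state and is only used for sorting: collapse compares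
-- configurations exactly.
record Entry : Set where
  constructor entry
  field
    key : ℕ
    size : ℕ
    state : State
    multiplicity : ℕ
open Entry

encode : ℕ → State → ℕ
encode k (labels , flags) =
  Vec.foldr′ (λ p n → toℕ p + 8 * n) (Vec.foldr′ (λ c n → (if c then 1 else 0) + 2 * n) k flags) labels

mkEntry : ℕ → State → ℕ → Entry
mkEntry k s c = entry (encode k s) k s c

open import Data.List.Sort.MergeSort (On.decTotalOrder ≤-decTotalOrder key) using (sort)
open import Data.List.Sort.MergeSort.Properties (On.decTotalOrder ≤-decTotalOrder key) using (sort-↭)

sameConfig? : ∀ e f → Dec (size e ≡ size f × state e ≡ state f)
sameConfig? e f =
  (size e ≟ size f) ×-dec ≡-dec (Vec.≡-dec _≟ᶠ_) (Vec.≡-dec _≟ᵇ_) (state e) (state f)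

collapse : Entry → List Entry → List Entry
collapse e [] = [ e ]
collapse e (f ∷ W) with sameConfig? e f
... | yes _ = collapse (record e { multiplicity = multiplicity e + multiplicity f }) W
... | no _ = e ∷ collapse f W

normalise : List Entry → List Entry
normalise W with sort W
... | [] = []
... | e ∷ es = collapse e es

prune : ℕ → List Entry → List Entry
prune n = filter (λ e → size e ≤? n)

module _ (value : ℕ → State → ℕ) where

  total : List Entry → ℕ
  total W = sum (map (λ e → multiplicity e * value (size e) (state e)) W)

  total-↭ : ∀ {V W} → V ↭ W → total V ≡ total W
  total-↭ V↭W = sum-↭ (↭.map⁺ _ V↭W)

  total-collapse : ∀ e W → total (collapse e W) ≡ total (e ∷ W)
  total-collapse e [] = refl
  total-collapse e (f ∷ W) with sameConfig? e f
  ... | no _ = cong (multiplicity e * value (size e) (state e) +_) (total-collapse f W)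
  ... | yes (same-size , same-state) = begin
    total (collapse (record e { multiplicity = c + d }) W)
      ≡⟨ total-collapse (record e { multiplicity = c + d }) W ⟩
    (c + d) * n + total W       ≡⟨ cong (_+ total W) (*-distribʳ-+ n c d) ⟩
    c * n + d * n + total W     ≡⟨ +-assoc (c * n) (d * n) (total W) ⟩
    c * n + (d * n + total W)   ≡⟨ cong (λ m → c * n + (d * m + total W)) (cong₂ value same-size same-state) ⟩
    total (e ∷ f ∷ W)           ∎
    where
    c d n : ℕ
    c = multiplicity e
    d = multiplicity f
    n = value (size e) (state e)

  total-normalise : ∀ W → total (normalise W) ≡ total W
  total-normalise W with sort W | total-↭ (sort-↭ W)
  ... | [] | sorted = sorted
  ... | e ∷ es | sorted = trans (total-collapse e es) sorted

  total-prune : ∀ n → (∀ k s → n <ℕ k → value k s ≡ 0) → ∀ W → total (prune n W) ≡ total W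
  total-prune n vanishes [] = refl
  total-prune n vanishes (e ∷ W) with size e ≤? n
  ... | yes fits = begin
    total (prune n (e ∷ W))                        ≡⟨ cong total (filter-accept (λ f → size f ≤? n) fits) ⟩
    total (e ∷ prune n W)                          ≡⟨ cong (multiplicity e * value (size e) (state e) +_) (total-prune n vanishes W) ⟩
    total (e ∷ W)                                  ∎
  ... | no tooBig = begin
    total (prune n (e ∷ W))                        ≡⟨ cong total (filter-reject (λ f → size f ≤? n) tooBig) ⟩
    total (prune n W)                              ≡⟨ total-prune n vanishes W ⟩
    total W                                        ≡⟨ cong (_+ total W) (sym (*-zeroʳ (multiplicity e))) ⟩
    multiplicity e * 0 + total W                   ≡⟨ cong (λ m → multiplicity e * m + total W) (sym (vanishes (size e) (state e) (≰⇒> tooBig))) ⟩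
    total (e ∷ W)                                  ∎

weight : List Entry → List Line → ℕ
weight W xs = total (count xs) W

expand : Line → List Entry → List Entry
expand x [] = []
expand x (e ∷ W) with size e
... | zero = e ∷ expand x W
... | suc k = e ∷ mkEntry k (insert (state e) x) (multiplicity e) ∷ expand x W

weight-expand : ∀ x W xs → weight (expand x W) xs ≡ weight W (x ∷ xs)
weight-expand x [] xs = refl
weight-expand x (entry _ zero s c ∷ W) xs = cong (c * count xs 0 s +_) (weight-expand x W xs)
weight-expand x (entry _ (suc k) s c ∷ W) xs = begin
  c * count xs (suc k) s + (c * count xs k (insert s x) + weight (expand x W) xs)
    ≡⟨ cong (λ t → c * count xs (suc k) s + (c * count xs k (insert s x) + t)) (weight-expand x W xs) ⟩
  c * count xs (suc k) s + (c * count xs k (insert s x) + weight W (x ∷ xs))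
    ≡⟨ solve 4 (λ c m n w → c :* n :+ (c :* m :+ w) := c :* (m :+ n) :+ w) refl
         c (count xs k (insert s x)) (count xs (suc k) s) (weight W (x ∷ xs)) ⟩
  c * (count xs k (insert s x) + count xs (suc k) s) + weight W (x ∷ xs)
    ≡⟨ cong (λ t → c * t + weight W (x ∷ xs)) (sym (count-∷ x xs k s)) ⟩
  c * count (x ∷ xs) (suc k) s + weight W (x ∷ xs) ∎

countDP : List Entry → List Line → ℕ
countDP W [] = weight W []
countDP W (x ∷ xs) = countDP (normalise (prune (length xs) (expand x W))) xs

countDP-correct : ∀ W xs → countDP W xs ≡ weight W xs
countDP-correct W [] = refl
countDP-correct W (x ∷ xs) = begin
  countDP (normalise (prune (length xs) (expand x W))) xs ≡⟨ countDP-correct _ xs ⟩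
  weight (normalise (prune (length xs) (expand x W))) xs  ≡⟨ total-normalise (count xs) (prune (length xs) (expand x W)) ⟩
  weight (prune (length xs) (expand x W)) xs              ≡⟨ total-prune (count xs) (length xs) (count-short xs) (expand x W) ⟩
  weight (expand x W) xs                                  ≡⟨ weight-expand x W xs ⟩
  weight W (x ∷ xs)                                       ∎

weight-singleton : ∀ xs k s → weight [ mkEntry k s 1 ] xs ≡ length (accepted xs k s)
weight-singleton xs k s = trans (+-identityʳ (1 * count xs k s)) (*-identityˡ (count xs k s))

-- Stated with length (accepted …) rather than count …: comparing the two would make the checker
-- evaluate the filter over all 8-sublists.
count-allLines : length (accepted allLines 8 discrete) ≡ 200970
count-allLines = begin
  length (accepted allLines 8 discrete)      ≡⟨ sym (weight-singleton allLines 8 discrete) ⟩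
  weight [ mkEntry 8 discrete 1 ] allLines   ≡⟨ sym (countDP-correct [ mkEntry 8 discrete 1 ] allLines) ⟩
  countDP [ mkEntry 8 discrete 1 ] allLines  ≡⟨⟩
  200970                                     ∎

allLines-unique : Unique allLines
allLines-unique = toWitness {a? = unique? (≡-dec _≟ᶠ_ _≟ᶠ_) allLines} _

allLines-ordered : All Ordered allLines
allLines-ordered = All.all-filter (λ l → proj₁ l <? proj₂ l) (cartesianProduct (allFin 8) (allFin 8))

Accepts-run⇔ : ∀ {C} → C ⊆ allLines → Accepts (run discrete C) ⇔ (OmitsNoPoint C × HasIsolatedTree C)
Accepts-run⇔ {C} C⊆ = Accepts⇔ (Tracks-run-discrete ordered (Unique-⊆ C⊆ allLines-unique)) ordered
  where
  ordered : All Ordered C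
  ordered = All-resp-⊆ C⊆ allLines-ordered

∈-accepted⇔ : ∀ C → C ∈ accepted allLines 8 discrete ⇔ (IsLineComplex C × HasIsolatedTree C × OmitsNoPoint C)
∈-accepted⇔ C = mk⇔ to from
  where
  to : C ∈ accepted allLines 8 discrete → IsLineComplex C × HasIsolatedTree C × OmitsNoPoint C
  to C∈ = (C⊆ , length≡8) , proj₂ properties , proj₁ properties
    where
    C∈sublists : C ∈ sublistsOfLength 8 allLines
    C∈sublists = proj₁ (∈-accepted⁻ allLines 8 discrete C∈)
    C⊆ : C ⊆ allLines
    C⊆ = proj₁ (∈-sublistsOfLength⁻ 8 allLines C∈sublists)
    length≡8 : length C ≡ 8
    length≡8 = proj₂ (∈-sublistsOfLength⁻ 8 allLines C∈sublists)
    properties : OmitsNoPoint C × HasIsolatedTree C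
    properties = Equivalence.to (Accepts-run⇔ C⊆) (proj₂ (∈-accepted⁻ allLines 8 discrete C∈))
  from : IsLineComplex C × HasIsolatedTree C × OmitsNoPoint C → C ∈ accepted allLines 8 discrete
  from ((C⊆ , length≡8) , tree , omitsNone) =
    ∈-accepted⁺ allLines 8 discrete (subst (λ k → C ∈ sublistsOfLength k allLines) length≡8 (∈-sublistsOfLength⁺ C⊆))
                (Equivalence.from (Accepts-run⇔ C⊆) (omitsNone , tree))

-- The statement's ∃ infers the element type as a setoid carrier; going through this Σ with the element
-- type spelled out keeps the checker from evaluating length (accepted allLines 8 discrete) to compare them.
Enumeration : {X : Set} → (X → Set) → ℕ → Set
Enumeration {X} P n = Σ[ L ∈ List X ] (Unique L × (∀ x → x ∈ L ⇔ P x) × length L ≡ n)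

enumeration : Enumeration (λ C → IsLineComplex C × HasIsolatedTree C × OmitsNoPoint C) 200970
enumeration = accepted allLines 8 discrete , accepted-unique allLines 8 discrete allLines-unique , ∈-accepted⇔ , count-allLines

mainTheorem10 : ∃[ L ] (Unique L
                  × (∀ (C : List Line) → (C ∈ L) ⇔ (IsLineComplex C × HasIsolatedTree C × OmitsNoPoint C))
                  × (length L ≡ 200970))
mainTheorem10 = enumeration
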